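{- Let $\Lambda=(\mathcal{L},\mathfrak{M},\models)$ be a reception-compatible satisfaction system and let $\oplus:\mathcal{P}_{\mathrm{fin}}(\mathcal{L})\times\mathcal{P}(\mathfrak{M})\to\mathcal{P}_{\mathrm{fin}}(\mathcal{L})$ be a model change operation. Then there exists a selection function $\gamma$ on $\Lambda$ such that $\mathrm{Mod}(\oplus(B,\mathbb{M}))=\gamma(\mathrm{FRsups}(\mathrm{Mod}(B)\cup\mathbb{M},\Lambda))$ for all $B\in\mathcal{P}_{\mathrm{fin}}(\mathcal{L})$ and $\mathbb{M}\subseteq\mathfrak{M}$ (i.e. $\oplus$ is a maxichoice reception function) if and only if $\oplus$ satisfies, for all $B,B'\in\mathcal{P}_{\mathrm{fin}}(\mathcal{L})$ and $\mathbb{M},\mathbb{M}'\subseteq\mathfrak{M}$: (success) $\mathbb{M}\subseteq\mathrm{Mod}(\oplus(B,\mathbb{M}))$; (persistence) $\mathrm{Mod}(B)\subseteq\mathrm{Mod}(\oplus(B,\mathbb{M}))$; (vacuity) if $\mathbb{M}\subseteq\mathrm{Mod}(B)$ then $\mathrm{Mod}(\oplus(B,\mathbb{M}))=\mathrm{Mod}(B)$; (finite temperance) if $\mathrm{Mod}(B)\cup\mathbb{M}\subseteq\mathbb{M}''\subsetneq\mathrm{Mod}(\oplus(B,\mathbb{M}))$ then $\mathbb{M}''\notin\mathrm{FR}(\Lambda)$; (uniformity) if $\mathrm{FRsups}(\mathrm{Mod}(B)\cup\mathbb{M},\Lambda)=\mathrm{FRsups}(\mathrm{Mod}(B')\cup\mathbb{M}',\Lambda)$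 then $\mathrm{Mod}(\oplus(B,\mathbb{M}))=\mathrm{Mod}(\oplus(B',\mathbb{M}'))$.
   Context: A satisfaction system is a triple $\Lambda=(\mathcal{L},\mathfrak{M},\models)$ where $\mathcal{L}$ is a set of formulae, $\mathfrak{M}$ a set of models, and $\models$ a relation between models and sets of formulae $B\subseteq\mathcal{L}$. $\mathrm{Mod}(B)=\{m\in\mathfrak{M}\mid m\models B\}$. $\mathcal{P}(A)$ is the power set of $A$, $\mathcal{P}_{\mathrm{fin}}(A)$ the set of finite subsets of $A$. $\mathrm{FR}(\Lambda)=\{X\subseteq\mathfrak{M}\mid X=\mathrm{Mod}(B)$ for some $B\in\mathcal{P}_{\mathrm{fin}}(\mathcal{L})\}$. For $\mathbb{M}\subseteq\mathfrak{M}$, $\mathrm{FRsups}(\mathbb{M},\Lambda)=\{X\in\mathrm{FR}(\Lambda)\mid \mathbb{M}\subseteq X$ and there is no $Y\in\mathrm{FR}(\Lambda)$ with $\mathbb{M}\subseteq Y\subsetneq X\}$. $\Lambda$ is reception-compatible if $\mathrm{FRsups}(\mathrm{Mod}(B)\cup\mathbb{M},\Lambda)\neq\emptyset$ for all $B\in\mathcal{P}_{\mathrm{fin}}(\mathcal{L})$ and $\mathbb{M}\subseteq\mathfrak{M}$. A model change operation is any function $\mathcal{P}_{\mathrm{fin}}(\mathcal{L})\times\mathcal{P}(\mathfrak{M})\to\mathcal{P}_{\mathrm{fin}}(\mathcal{L})$. A selection function on $\Lambda$ is a map $\gamma$ from the nonempty subsets of $\mathrm{FR}(\Lambda)$ to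 $\mathrm{FR}(\Lambda)$ with $\gamma(X)\in X$ for every nonempty $X\subseteq\mathrm{FR}(\Lambda)$. -}

module Defs where

open import Level using (0ℓ)
open import Data.List using (List)
open import Data.List.Membership.Propositional renaming (_∈_ to _∈ₗ_)
open import Data.Product using (Σ; _×_; _,_; proj₁; proj₂)
open import Relation.Nullary using (¬_; Dec)
open import Relation.Unary using (Pred; _⊆_; _≐_; _∪_)
open import Function.Bundles using (_⇔_)

record SatSystem : Set₁ where
  field
    Formula : Set
    Model   : Set
    _⊨_     : Model → Pred Formula 0ℓ → Set

LEM : Set₂
LEM = (P : Set₁) → Dec P

module _ (Λ : SatSystem) where
  open SatSystem Λ

  ModelSet : Set₁
  ModelSet = Pred Model 0ℓ

  -- P_fin(ℒ): finite sets of formulae, represented by lists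
  FinSet : Set
  FinSet = List Formula

  ⟦_⟧ : FinSet → Pred Formula 0ℓ
  ⟦ B ⟧ φ = φ ∈ₗ B

  Mod : FinSet → ModelSet
  Mod B m = m ⊨ ⟦ B ⟧

  FR : ModelSet → Set
  FR X = Σ FinSet λ B → X ≐ Mod B

  _⊊_ : ModelSet → ModelSet → Set
  Y ⊊ X = (Y ⊆ X) × ¬ (Y ≐ X)

  FRsups : ModelSet → ModelSet → Set₁
  FRsups 𝕄 X = FR X × (𝕄 ⊆ X) × ¬ (Σ ModelSet λ Y → FR Y × (𝕄 ⊆ Y) × (Y ⊊ X))

  ReceptionCompatible : Set₁
  ReceptionCompatible = (B : FinSet) (𝕄 : ModelSet) → Σ ModelSet (FRsups (Mod B ∪ 𝕄))

  Family : Set₂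
  Family = ModelSet → Set₁

  Closed : Family → Set₁
  Closed 𝒳 = ∀ {X Y} → X ≐ Y → 𝒳 X → 𝒳 Y

  FR-closed : ∀ {X Y} → X ≐ Y → FR X → FR Y
  FR-closed (p , q) (B , r , s) = B , (λ y → r (q y)) , (λ m → p (s m))

  FRsups-closed : (𝕄 : ModelSet) → Closed (FRsups 𝕄)
  FRsups-closed 𝕄 {X} {Y} (p , q) (fx , sub , nomin) =
    FR-closed (p , q) fx , (λ m → p (sub m)) ,
    λ { (Z , fz , sz , (z⊆y , z≠y)) →
          nomin (Z , fz , sz , (λ z → q (z⊆y z)) ,
                 λ { (a , b) → z≠y ((λ z → p (a z)) , (λ y → b (q y))) }) }

  -- Selection function: maps every nonempty (extensionally closed) subset 𝒳 of FR(Λ)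
  -- to an element of 𝒳; as a function on sets it does not depend on the proofs and
  -- respects extensional equality of its argument.
  record Selection : Set₂ where
    field
      γ     : (𝒳 : Family) → .(Closed 𝒳) → .(∀ {X} → 𝒳 X → FR X) → .(Σ ModelSet 𝒳) → ModelSet
      γ-∈   : ∀ 𝒳 .(c : Closed 𝒳) .(s : ∀ {X} → 𝒳 X → FR X) .(ne : Σ ModelSet 𝒳) → 𝒳 (γ 𝒳 c s ne)
      γ-ext : ∀ 𝒳 𝒴 .(c : Closed 𝒳) .(s : ∀ {X} → 𝒳 X → FR X) .(ne : Σ ModelSet 𝒳)
                .(c' : Closed 𝒴) .(s' : ∀ {X} → 𝒴 X → FR X) .(ne' : Σ ModelSet 𝒴) →
              𝒳 ≐ 𝒴 → γ 𝒳 c s ne ≐ γ 𝒴 c' s' ne'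

  -- Axiom of choice (as an extensional global choice on nonempty closed families of model sets).
  record Choice : Set₂ where
    field
      ε     : (𝒳 : Family) → .(Closed 𝒳) → .(Σ ModelSet 𝒳) → ModelSet
      ε-∈   : ∀ 𝒳 .(c : Closed 𝒳) .(ne : Σ ModelSet 𝒳) → 𝒳 (ε 𝒳 c ne)
      ε-ext : ∀ 𝒳 𝒴 .(c : Closed 𝒳) .(ne : Σ ModelSet 𝒳) .(c' : Closed 𝒴) .(ne' : Σ ModelSet 𝒴) →
              𝒳 ≐ 𝒴 → ε 𝒳 c ne ≐ ε 𝒴 c' ne'

  ModelChange : Set₁
  ModelChange = FinSet → ModelSet → FinSet

  Maxichoice : ReceptionCompatible → Selection → ModelChange → Set₁
  Maxichoice rc S ⊕ = (B : FinSet) (𝕄 : ModelSet) →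
    Mod (⊕ B 𝕄) ≐ Selection.γ S (FRsups (Mod B ∪ 𝕄)) (FRsups-closed (Mod B ∪ 𝕄)) proj₁ (rc B 𝕄)

  Success : ModelChange → Set₁
  Success ⊕ = (B : FinSet) (𝕄 : ModelSet) → 𝕄 ⊆ Mod (⊕ B 𝕄)

  Persistence : ModelChange → Set₁
  Persistence ⊕ = (B : FinSet) (𝕄 : ModelSet) → Mod B ⊆ Mod (⊕ B 𝕄)

  Vacuity : ModelChange → Set₁
  Vacuity ⊕ = (B : FinSet) (𝕄 : ModelSet) → 𝕄 ⊆ Mod B → Mod (⊕ B 𝕄) ≐ Mod B

  FiniteTemperance : ModelChange → Set₁
  FiniteTemperance ⊕ = (B : FinSet) (𝕄 𝕄'' : ModelSet) →
    (Mod B ∪ 𝕄) ⊆ 𝕄'' → 𝕄'' ⊊ Mod (⊕ B 𝕄) → ¬ FR 𝕄''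

  Uniformity : ModelChange → Set₁
  Uniformity ⊕ = (B B' : FinSet) (𝕄 𝕄' : ModelSet) →
    FRsups (Mod B ∪ 𝕄) ≐ FRsups (Mod B' ∪ 𝕄') → Mod (⊕ B 𝕄) ≐ Mod (⊕ B' 𝕄')

module Submission where

-- Success, persistence and finite temperance say exactly that Mod(⊕(B,𝕄)) is an
-- element of FRsups(Mod B ∪ 𝕄); vacuity then follows from its minimality, and
-- uniformity from the extensionality of γ. Conversely, uniformity makes
-- "FRsups(Mod B ∪ 𝕄) ↦ Mod(⊕(B,𝕄))" a well-defined choice on the families of this
-- form; excluded middle recognises those families and global choice handles the rest.

open import Defs
open import Level using (Lift; lift; lower)
open import Data.Product using (Σ; _×_; _,_; proj₁; proj₂)
open import Data.Sum using (inj₁; inj₂; [_,_])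
open import Data.Empty using (⊥-elim)
open import Function using (id)
open import Function.Bundles using (_⇔_; mk⇔)
open import Relation.Nullary using (¬_; Dec; yes; no)
open import Relation.Nullary.Decidable using (map′; decidable-stable)
open import Relation.Unary using (_⊆_; _≐_; _∪_)
open import Relation.Unary.Properties using (≐-refl; ≐-sym; ≐-trans)

LEM⇒stable : LEM → {P : Set} → ¬ ¬ P → P
LEM⇒stable lem {P} = decidable-stable (map′ lower lift (lem (Lift _ P)))

module _ (Λ : SatSystem) where

  FR-Mod : (B : FinSet Λ) → FR Λ (Mod Λ B)
  FR-Mod B = B , ≐-refl

  FRsups-⊇ : ∀ {𝕄 X} → FRsups Λ 𝕄 X → 𝕄 ⊆ X
  FRsups-⊇ (_ , 𝕄⊆X , _) = 𝕄⊆X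

  FRsups-minimal : ∀ {𝕄 X Y} → FRsups Λ 𝕄 X → FR Λ Y → 𝕄 ⊆ Y → Y ⊆ X → ¬ ¬ (Y ≐ X)
  FRsups-minimal (_ , _ , noSmaller) frY 𝕄⊆Y Y⊆X Y≭X = noSmaller (_ , frY , 𝕄⊆Y , Y⊆X , Y≭X)

  SelectsFRsup : ModelChange Λ → Set₁
  SelectsFRsup ⊕ = (B : FinSet Λ) (𝕄 : ModelSet Λ) → FRsups Λ (Mod Λ B ∪ 𝕄) (Mod Λ (⊕ B 𝕄))

  module _ {⊕ : ModelChange Λ} (sups : SelectsFRsup ⊕) where

    selectsFRsup⇒success : Success Λ ⊕
    selectsFRsup⇒success B 𝕄 m∈𝕄 = FRsups-⊇ (sups B 𝕄) (inj₂ m∈𝕄)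

    selectsFRsup⇒persistence : Persistence Λ ⊕
    selectsFRsup⇒persistence B 𝕄 m∈B = FRsups-⊇ (sups B 𝕄) (inj₁ m∈B)

    selectsFRsup⇒finiteTemperance : FiniteTemperance Λ ⊕
    selectsFRsup⇒finiteTemperance B 𝕄 𝕄'' B∪𝕄⊆𝕄'' (𝕄''⊆ , 𝕄''≭) fr =
      FRsups-minimal (sups B 𝕄) fr B∪𝕄⊆𝕄'' 𝕄''⊆ 𝕄''≭

    selectsFRsup⇒vacuity : LEM → Vacuity Λ ⊕
    selectsFRsup⇒vacuity lem B 𝕄 𝕄⊆B = ≐-sym (LEM⇒stable lem
      (FRsups-minimal (sups B 𝕄) (FR-Mod B) [ id , 𝕄⊆B ] (selectsFRsup⇒persistence B 𝕄)))

  success∧persistence∧finiteTemperance⇒selectsFRsup : {⊕ : ModelChange Λ} →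
    Success Λ ⊕ → Persistence Λ ⊕ → FiniteTemperance Λ ⊕ → SelectsFRsup ⊕
  success∧persistence∧finiteTemperance⇒selectsFRsup {⊕} success persistence temperance B 𝕄 =
    FR-Mod (⊕ B 𝕄) , [ persistence B 𝕄 , success B 𝕄 ] ,
    λ (Y , frY , B∪𝕄⊆Y , Y⊊) → temperance B 𝕄 Y B∪𝕄⊆Y Y⊊ frY

  module _ {rc : ReceptionCompatible Λ} {S : Selection Λ} {⊕ : ModelChange Λ}
           (maxichoice : Maxichoice Λ rc S ⊕) where
    open Selection S

    maxichoice⇒selectsFRsup : SelectsFRsup ⊕
    maxichoice⇒selectsFRsup B 𝕄 =
      FRsups-closed Λ _ (≐-sym (maxichoice B 𝕄)) (γ-∈ _ (FRsups-closed Λ _) proj₁ (rc B 𝕄))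

    maxichoice⇒uniformity : Uniformity Λ ⊕
    maxichoice⇒uniformity B B' 𝕄 𝕄' sups≐sups' =
      ≐-trans (maxichoice B 𝕄)
        (≐-trans (γ-ext _ _ (FRsups-closed Λ _) proj₁ (rc B 𝕄) (FRsups-closed Λ _) proj₁ (rc B' 𝕄')
                   sups≐sups')
                 (≐-sym (maxichoice B' 𝕄')))

  ReceptionFamily : Family Λ → Set₁
  ReceptionFamily 𝒳 = Σ (FinSet Λ) λ B → Σ (ModelSet Λ) λ 𝕄 → 𝒳 ≐ FRsups Λ (Mod Λ B ∪ 𝕄)

  ReceptionFamily-resp-≐ : ∀ {𝒳 𝒴} → 𝒳 ≐ 𝒴 → ReceptionFamily 𝒳 → ReceptionFamily 𝒴
  ReceptionFamily-resp-≐ 𝒳≐𝒴 (B , 𝕄 , 𝒳≐) = B , 𝕄 , ≐-trans (≐-sym 𝒳≐𝒴) 𝒳≐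

  module SelectionOf (lem : LEM) (ch : Choice Λ) {⊕ : ModelChange Λ}
                     (sups : SelectsFRsup ⊕) (uniformity : Uniformity Λ ⊕) where
    open Choice ch

    select : (𝒳 : Family Λ) → .(Closed Λ 𝒳) → .(Σ (ModelSet Λ) 𝒳) →
             Dec (ReceptionFamily 𝒳) → ModelSet Λ
    select _ _ _ (yes (B , 𝕄 , _)) = Mod Λ (⊕ B 𝕄)
    select 𝒳 closed nonempty (no _) = ε 𝒳 closed nonempty

    γ : (𝒳 : Family Λ) → .(Closed Λ 𝒳) → .(∀ {X} → 𝒳 X → FR Λ X) → .(Σ (ModelSet Λ) 𝒳) →
        ModelSet Λ
    γ 𝒳 closed _ nonempty = select 𝒳 closed nonempty (lem (ReceptionFamily 𝒳))

    γ-∈ : ∀ 𝒳 .(closed : Closed Λ 𝒳) .(inFR : ∀ {X} → 𝒳 X → FR Λ X)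
            .(nonempty : Σ (ModelSet Λ) 𝒳) → 𝒳 (γ 𝒳 closed inFR nonempty)
    γ-∈ 𝒳 closed _ nonempty with lem (ReceptionFamily 𝒳)
    ... | yes (B , 𝕄 , 𝒳≐) = proj₂ 𝒳≐ (sups B 𝕄)
    ... | no _ = ε-∈ 𝒳 closed nonempty

    γ-ext : ∀ 𝒳 𝒴 .(closed : Closed Λ 𝒳) .(inFR : ∀ {X} → 𝒳 X → FR Λ X)
              .(nonempty : Σ (ModelSet Λ) 𝒳) .(closed' : Closed Λ 𝒴)
              .(inFR' : ∀ {X} → 𝒴 X → FR Λ X) .(nonempty' : Σ (ModelSet Λ) 𝒴) →
            𝒳 ≐ 𝒴 → γ 𝒳 closed inFR nonempty ≐ γ 𝒴 closed' inFR' nonempty'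
    γ-ext 𝒳 𝒴 closed _ nonempty closed' _ nonempty' 𝒳≐𝒴
      with lem (ReceptionFamily 𝒳) | lem (ReceptionFamily 𝒴)
    ... | yes (B , 𝕄 , 𝒳≐) | yes (B' , 𝕄' , 𝒴≐) =
          uniformity B B' 𝕄 𝕄' (≐-trans (≐-sym 𝒳≐) (≐-trans 𝒳≐𝒴 𝒴≐))
    ... | yes r | no ¬r = ⊥-elim (¬r (ReceptionFamily-resp-≐ 𝒳≐𝒴 r))
    ... | no ¬r | yes r = ⊥-elim (¬r (ReceptionFamily-resp-≐ (≐-sym 𝒳≐𝒴) r))
    ... | no _ | no _ = ε-ext 𝒳 𝒴 closed nonempty closed' nonempty' 𝒳≐𝒴

    selection : Selection Λ
    selection = record { γ = γ ; γ-∈ = γ-∈ ; γ-ext = γ-ext }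

    maxichoice : (rc : ReceptionCompatible Λ) → Maxichoice Λ rc selection ⊕
    maxichoice _ B 𝕄 with lem (ReceptionFamily (FRsups Λ (Mod Λ B ∪ 𝕄)))
    ... | yes (B' , 𝕄' , sups≐) = uniformity B B' 𝕄 𝕄' sups≐
    ... | no ¬r = ⊥-elim (¬r (B , 𝕄 , ≐-refl))

theorem2 : (Λ : SatSystem) → LEM → Choice Λ → (rc : ReceptionCompatible Λ) →
           (⊕ : ModelChange Λ) →
           (Σ (Selection Λ) λ S → Maxichoice Λ rc S ⊕) ⇔
           (Success Λ ⊕ × Persistence Λ ⊕ × Vacuity Λ ⊕ × FiniteTemperance Λ ⊕ × Uniformity Λ ⊕)
theorem2 Λ lem ch rc ⊕ = mk⇔ forward backward
  where
  forward : Σ (Selection Λ) (λ S → Maxichoice Λ rc S ⊕) →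
            Success Λ ⊕ × Persistence Λ ⊕ × Vacuity Λ ⊕ × FiniteTemperance Λ ⊕ × Uniformity Λ ⊕
  forward (S , mc) =
    selectsFRsup⇒success Λ sups , selectsFRsup⇒persistence Λ sups ,
    selectsFRsup⇒vacuity Λ sups lem , selectsFRsup⇒finiteTemperance Λ sups ,
    maxichoice⇒uniformity Λ {rc} {S} mc
    where
    sups : SelectsFRsup Λ ⊕
    sups = maxichoice⇒selectsFRsup Λ {rc} {S} mc

  backward : Success Λ ⊕ × Persistence Λ ⊕ × Vacuity Λ ⊕ × FiniteTemperance Λ ⊕ × Uniformity Λ ⊕ →
             Σ (Selection Λ) (λ S → Maxichoice Λ rc S ⊕)
  backward (success , persistence , _ , temperance , uniformity) =
    selection , maxichoice rc
    where
    open SelectionOf Λ lem ch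
           (success∧persistence∧finiteTemperance⇒selectsFRsup Λ success persistence temperance)
           uniformity
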